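{- Let $h,l\ge1$ and let $\lambda=(h,1,1,\dots,1)$ be a hook partition with $l$ parts, and let $\mathbf{1}=(1,\dots,1)$ have $|\lambda|$ parts. Then $\mathcal{P}_{\lambda,\mathbf{1}}$ is integrally closed: for every positive integer $k$, every lattice point of the $k$-th dilation $k\mathcal{P}_{\lambda,\mathbf{1}}$ is a sum of $k$ lattice points of $\mathcal{P}_{\lambda,\mathbf{1}}$.
   Context: $\mathcal{P}_{\lambda,\mathbf{w}}$ denotes $\mathcal{P}_{\lambda/\mu,\mathbf{w}}$ with $\mu=0$ the empty partition. For a composition $\mathbf{w}=(w_1,\dots,w_{m-1})$ of positive integers, a Gelfand--Tsetlin (GT) pattern is a real array $(x^i_j)_{1\le i\le m,\,1\le j\le n}$ ($n$ at least the length of $\lambda$, partitions padded with zeros) with $x^{i+1}_j\ge x^i_j$ and $x^i_j\ge x^{i+1}_{j+1}$ whenever defined; $\mathcal{P}_{\lambda/\mu,\mathbf{w}}\subset\mathbb{R}^{mn}$ is the polytope of GT patterns with $\mathbf{x}^m=\lambda$, $\mathbf{x}^1=\mu$, and $\sum_jx^{i+1}_j-\sum_jx^i_j=w_i$ for $i=1,\dots,m-1$. The $k$-th dilation is $k\mathcal{P}_{\lambda/\mu,\mathbf{w}}=\mathcal{P}_{k\lambda/k\mu,k\mathbf{w}}$. -}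

module Defs where

open import Data.Nat using (ℕ; zero; suc)
open import Data.Fin using (Fin; zero; suc; toℕ; inject₁; fromℕ)
open import Data.Integer using (ℤ; +_; _+_; _-_; _*_; _≤_)
open import Data.Product using (_×_)
open import Relation.Binary.PropositionalEquality using (_≡_)

finSum : (k : ℕ) → (Fin k → ℤ) → ℤ
finSum zero    f = + 0
finSum (suc k) f = f zero + finSum k (λ t → f (suc t))

-- A real array (x^i_j) with m = suc r rows and n columns; we use 0-based
-- indices: row i : Fin (suc r) (row 0 = paper's row 1, row r = paper's row m),
-- column j : Fin n.  Lattice points are integer arrays.
Array : ℕ → ℕ → Set
Array r n = Fin (suc r) → Fin n → ℤ

IsGT : (r n : ℕ) → Array r n → Set
IsGT r n x =
  ((i : Fin r) (j : Fin n) → x (inject₁ i) j ≤ x (suc i) j) ×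
  ((i : Fin r) (j j' : Fin n) → toℕ j' ≡ suc (toℕ j) → x (suc i) j' ≤ x (inject₁ i) j)

-- Lattice points of P_{λ/μ,w} ⊂ ℝ^{mn}: integer GT patterns with top row λ,
-- bottom row μ, and row-sum differences given by w.
InP : (r n : ℕ) (lam mu : Fin n → ℤ) (w : Fin r → ℤ) → Array r n → Set
InP r n lam mu w x =
  IsGT r n x ×
  ((j : Fin n) → x (fromℕ r) j ≡ lam j) ×
  ((j : Fin n) → x zero j ≡ mu j) ×
  ((i : Fin r) → finSum n (x (suc i)) - finSum n (x (inject₁ i)) ≡ w i)

-- Scaling a vector by a natural number k (used for k-th dilation
-- kP_{λ/μ,w} = P_{kλ/kμ,kw}).
scale : {A : Set} → ℕ → (A → ℤ) → (A → ℤ)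
scale k f a = + k * f a

hook : ℕ → {l : ℕ} → Fin l → ℤ
hook h zero    = + h
hook h (suc _) = + 1

zeroVec : {n : ℕ} → Fin n → ℤ
zeroVec _ = + 0

onesVec : {r : ℕ} → Fin r → ℤ
onesVec _ = + 1

module Submission where

open import Defs
open import Data.Nat using (ℕ; suc; _+_; _∸_; _≤_)
open import Data.Fin using (Fin)
open import Data.Product using (Σ; _×_)
open import Relation.Binary.PropositionalEquality using (_≡_)

open import Data.Nat using (zero; z≤n; s≤s; _<_; _<?_)
import Data.Nat.Properties as NP
open import Data.Fin using (zero; suc; toℕ; inject₁; fromℕ)
import Data.Fin.Properties as FP
open import Data.Integer using (ℤ; +_; ∣_∣)
  renaming (_+_ to _+ᶻ_; _-_ to _-ᶻ_; _*_ to _*ᶻ_; _≤_ to _≤ᶻ_; _<?_ to _<ᶻ?_)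
import Data.Integer as Z
import Data.Integer.Properties as ZP
open import Algebra.Bundles using (AbelianGroup)
open import Algebra.Properties.Group (AbelianGroup.group ZP.+-0-abelianGroup)
  using (∙-cancelʳ) renaming (//-rightDividesˡ to i-j+j≡i; //-rightDividesʳ to i+j-j≡i)
open import Algebra.Properties.CommutativeSemigroup ZP.+-commutativeSemigroup
  using () renaming (interchange to +-interchange)
open import Data.Product using (_,_; proj₁; proj₂)
open import Data.Empty using (⊥-elim)
open import Relation.Nullary using (Dec; yes; no; ¬_)
open import Relation.Binary.PropositionalEquality
  using (refl; sym; trans; cong; cong₂; subst; module ≡-Reasoning)

-- Proof idea (layer-cake decomposition).  Let x be a lattice point of
-- kP_{λ,1}, with λ = (h,1,…,1) having l = m + 1 parts.  Interlacing forces
-- every entry of columns 1,…,m to lie in [0,k], since these columns run from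
-- the bottom value 0 to the top value k.  For a threshold t < k the layer y_t
-- records in column j ≥ 1 the indicator [x^i_j > t], and in column 0 whatever
-- makes row i sum to i (as it must in P_{λ,1}).  Each layer is a GT pattern in
-- P_{λ,1}: the indicator columns inherit monotonicity and interlacing from x,
-- and column 0 is controlled by counting, row by row, the entries above t.
-- Summing over t recovers columns j ≥ 1 (since Σ_{t<k}[n > t] = n for n ≤ k)
-- and then column 0 from the row sums.

finSum-cong : ∀ k (f g : Fin k → ℤ) → (∀ t → f t ≡ g t) → finSum k f ≡ finSum k g
finSum-cong zero    f g f≡g = refl
finSum-cong (suc k) f g f≡g = cong₂ _+ᶻ_ (f≡g zero) (finSum-cong k _ _ (λ t → f≡g (suc t)))

finSum-+ : ∀ k (f g : Fin k → ℤ) → finSum k (λ t → f t +ᶻ g t) ≡ finSum k f +ᶻ finSum k g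
finSum-+ zero    f g = refl
finSum-+ (suc k) f g =
  trans (cong ((f zero +ᶻ g zero) +ᶻ_) (finSum-+ k (λ t → f (suc t)) (λ t → g (suc t))))
        (+-interchange (f zero) (g zero) (finSum k (λ t → f (suc t))) (finSum k (λ t → g (suc t))))

finSum-const : ∀ k c → finSum k (λ _ → c) ≡ + k *ᶻ c
finSum-const zero    c = sym (ZP.*-zeroˡ c)
finSum-const (suc k) c = trans (cong (c +ᶻ_) (finSum-const k c)) (sym (ZP.suc-* (+ k) c))

finSum-swap : ∀ k m (F : Fin k → Fin m → ℤ) →
  finSum k (λ t → finSum m (F t)) ≡ finSum m (λ j → finSum k (λ t → F t j))
finSum-swap zero    m F = sym (trans (finSum-const m (+ 0)) (ZP.*-zeroʳ (+ m)))
finSum-swap (suc k) m F =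
  trans (cong (finSum m (F zero) +ᶻ_) (finSum-swap k m (λ t → F (suc t))))
        (sym (finSum-+ m (F zero) (λ j → finSum k (λ t → F (suc t) j))))

above : ℕ → ℤ → ℕ
above t z with + t <ᶻ? z
... | yes _ = 1
... | no  _ = 0

above≤1 : ∀ t z → above t z ≤ 1
above≤1 t z with + t <ᶻ? z
... | yes _ = s≤s z≤n
... | no  _ = z≤n

above-mono : ∀ t {z z'} → z ≤ᶻ z' → above t z ≤ above t z'
above-mono t {z} {z'} z≤z' with + t <ᶻ? z | + t <ᶻ? z'
... | yes _   | yes _    = s≤s z≤n
... | yes t<z | no  t≮z' = ⊥-elim (t≮z' (ZP.<-≤-trans t<z z≤z'))
... | no  _   | _        = z≤n

above-< : ∀ t n → t < n → above t (+ n) ≡ 1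
above-< t n t<n with + t <ᶻ? + n
... | yes _   = refl
... | no  t≮n = ⊥-elim (t≮n (Z.+<+ t<n))

above-≮ : ∀ t n → ¬ (t < n) → above t (+ n) ≡ 0
above-≮ t n t≮n with + t <ᶻ? + n
... | yes t<n = ⊥-elim (t≮n (ZP.drop‿+<+ t<n))
... | no  _   = refl

above-step : ∀ a n → above a (+ n) + (n ∸ suc a) ≡ n ∸ a
above-step a n = byCases (a <? n)
  where
  byCases : Dec (a < n) → above a (+ n) + (n ∸ suc a) ≡ n ∸ a
  byCases (yes a<n) rewrite above-< a n a<n = sym (NP.+-∸-assoc 1 a<n)
  byCases (no  a≮n) rewrite above-≮ a n a≮n
                          | NP.m≤n⇒m∸n≡0 (NP.≮⇒≥ a≮n)
                          | NP.m≤n⇒m∸n≡0 (NP.≤-trans (NP.≮⇒≥ a≮n) (NP.n≤1+n a)) = refl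

layerCake-from : ∀ k a n → n ≤ a + k → finSum k (λ t → + above (a + toℕ t) (+ n)) ≡ + (n ∸ a)
layerCake-from zero    a n n≤a rewrite NP.+-identityʳ a | NP.m≤n⇒m∸n≡0 n≤a = refl
layerCake-from (suc k) a n n≤a+k+1 = begin
  + above (a + 0) (+ n) +ᶻ finSum k (λ t → + above (a + suc (toℕ t)) (+ n))
    ≡⟨ cong₂ (λ b s → + above b (+ n) +ᶻ s) (NP.+-identityʳ a)
             (finSum-cong k _ _ (λ t → cong (λ b → + above b (+ n)) (NP.+-suc a (toℕ t)))) ⟩
  + above a (+ n) +ᶻ finSum k (λ t → + above (suc a + toℕ t) (+ n))
    ≡⟨ cong (+ above a (+ n) +ᶻ_)
            (layerCake-from k (suc a) n (subst (n ≤_) (NP.+-suc a k) n≤a+k+1)) ⟩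
  + (above a (+ n) + (n ∸ suc a))
    ≡⟨ cong +_ (above-step a n) ⟩
  + (n ∸ a) ∎
  where open ≡-Reasoning

layerCake : ∀ k n → n ≤ k → finSum k (λ t → + above (toℕ t) (+ n)) ≡ + n
layerCake k n n≤k = layerCake-from k 0 n n≤k

countAbove : ∀ {m} → ℕ → (Fin m → ℤ) → ℕ
countAbove {zero}  t f = 0
countAbove {suc m} t f = above t (f zero) + countAbove t (λ j → f (suc j))

finSum-above : ∀ m t (f : Fin m → ℤ) → finSum m (λ j → + above t (f j)) ≡ + countAbove t f
finSum-above zero    t f = refl
finSum-above (suc m) t f = cong (+ above t (f zero) +ᶻ_) (finSum-above m t (λ j → f (suc j)))

countAbove-mono : ∀ {m} t (f g : Fin m → ℤ) → (∀ j → f j ≤ᶻ g j) → countAbove t f ≤ countAbove t g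
countAbove-mono {zero}  t f g f≤g = z≤n
countAbove-mono {suc m} t f g f≤g =
  NP.+-mono-≤ (above-mono t (f≤g zero)) (countAbove-mono t _ _ (λ j → f≤g (suc j)))

countAbove-init : ∀ {m} t (f : Fin (suc m) → ℤ) → countAbove t (λ j → f (inject₁ j)) ≤ countAbove t f
countAbove-init {zero}  t f = z≤n
countAbove-init {suc m} t f = NP.+-monoʳ-≤ (above t (f zero)) (countAbove-init t (λ j → f (suc j)))

Interlaces : ∀ {m} → (g f : Fin m → ℤ) → Set
Interlaces g f = ∀ j j' → toℕ j' ≡ suc (toℕ j) → g j' ≤ᶻ f j

countAbove-interlace : ∀ {m} t (g f : Fin (suc m) → ℤ) → Interlaces g f →
  countAbove t g ≤ above t (g zero) + countAbove t f
countAbove-interlace t g f g≼f = NP.+-monoʳ-≤ (above t (g zero))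
  (NP.≤-trans (countAbove-mono t _ _ (λ j → g≼f (inject₁ j) (suc j) (cong suc (sym (FP.toℕ-inject₁ j)))))
              (countAbove-init t f))

countAbove-interlace-suc : ∀ {m} t (g f : Fin m → ℤ) → Interlaces g f →
  countAbove t g ≤ suc (countAbove t f)
countAbove-interlace-suc {zero}  t g f g≼f = z≤n
countAbove-interlace-suc {suc m} t g f g≼f =
  NP.≤-trans (countAbove-interlace t g f g≼f) (NP.+-monoˡ-≤ _ (above≤1 t (g zero)))

countAbove-const : ∀ {m} t n (f : Fin m → ℤ) → t < n → (∀ j → f j ≡ + n) → countAbove t f ≡ m
countAbove-const {zero}  t n f t<n f≡n = refl
countAbove-const {suc m} t n f t<n f≡n rewrite f≡n zero | above-< t n t<n =
  cong suc (countAbove-const t n _ t<n (λ j → f≡n (suc j)))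

countAbove-zeros : ∀ {m} t (f : Fin m → ℤ) → (∀ j → f j ≡ + 0) → countAbove t f ≡ 0
countAbove-zeros {zero}  t f f≡0 = refl
countAbove-zeros {suc m} t f f≡0 rewrite f≡0 zero | above-≮ t 0 (λ ()) =
  countAbove-zeros t _ (λ j → f≡0 (suc j))

increasing-≥first : ∀ r (s : Fin (suc r) → ℤ) → (∀ (i : Fin r) → s (inject₁ i) ≤ᶻ s (suc i)) →
  ∀ i → s zero ≤ᶻ s i
increasing-≥first r       s s↑ zero    = ZP.≤-refl
increasing-≥first (suc r) s s↑ (suc i) =
  ZP.≤-trans (s↑ zero) (increasing-≥first r (λ u → s (suc u)) (λ u → s↑ (suc u)) i)

increasing-≤last : ∀ r (s : Fin (suc r) → ℤ) → (∀ (i : Fin r) → s (inject₁ i) ≤ᶻ s (suc i)) →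
  ∀ i → s i ≤ᶻ s (fromℕ r)
increasing-≤last zero    s s↑ zero    = ZP.≤-refl
increasing-≤last (suc r) s s↑ zero    =
  ZP.≤-trans (s↑ zero) (increasing-≤last r (λ u → s (suc u)) (λ u → s↑ (suc u)) zero)
increasing-≤last (suc r) s s↑ (suc i) = increasing-≤last r (λ u → s (suc u)) (λ u → s↑ (suc u)) i

unitSteps-bound : ∀ r (c : Fin (suc r) → ℕ) a → c zero ≤ a →
  (∀ (i : Fin r) → c (suc i) ≤ suc (c (inject₁ i))) → ∀ i → c i ≤ a + toℕ i
unitSteps-bound r       c a c₀≤a steps zero    = subst (c zero ≤_) (sym (NP.+-identityʳ a)) c₀≤a
unitSteps-bound (suc r) c a c₀≤a steps (suc i) =
  subst (c (suc i) ≤_) (sym (NP.+-suc a (toℕ i)))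
    (unitSteps-bound r (λ u → c (suc u)) (suc a) (NP.≤-trans (steps zero) (s≤s c₀≤a))
                     (λ u → steps (suc u)) i)

arithProgression : ∀ r (s : Fin (suc r) → ℤ) d → (∀ (i : Fin r) → s (suc i) -ᶻ s (inject₁ i) ≡ d) →
  ∀ i → s i ≡ s zero +ᶻ + toℕ i *ᶻ d
arithProgression r       s d steps zero    = sym (ZP.+-identityʳ (s zero))
arithProgression (suc r) s d steps (suc i) = begin
  s (suc i)
    ≡⟨ arithProgression r (λ u → s (suc u)) d (λ u → steps (suc u)) i ⟩
  s (suc zero) +ᶻ + toℕ i *ᶻ d
    ≡⟨ cong (_+ᶻ + toℕ i *ᶻ d) s₁ ⟩
  (s zero +ᶻ d) +ᶻ + toℕ i *ᶻ d
    ≡⟨ ZP.+-assoc (s zero) d (+ toℕ i *ᶻ d) ⟩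
  s zero +ᶻ (d +ᶻ + toℕ i *ᶻ d)
    ≡⟨ cong (s zero +ᶻ_) (sym (ZP.suc-* (+ toℕ i) d)) ⟩
  s zero +ᶻ + suc (toℕ i) *ᶻ d ∎
  where
  open ≡-Reasoning
  s₁ : s (suc zero) ≡ s zero +ᶻ d
  s₁ = trans (sym (i-j+j≡i (s zero) (s (suc zero))))
             (trans (cong (_+ᶻ s zero) (steps zero)) (ZP.+-comm d (s zero)))

-- The layers of a lattice point x of kP_{λ,1}, where λ = (h,1,…,1) has
-- m + 1 parts and the pattern has r + 1 = |λ| + 1 rows.
module Layers (h m r : ℕ) (r≡h+m : r ≡ h + m) (k : ℕ) (x : Array r (suc m))
  (x∈kP : InP r (suc m) (scale k (hook h)) (scale k zeroVec) (scale k onesVec) x) where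

  x-increasing : ∀ (i : Fin r) j → x (inject₁ i) j ≤ᶻ x (suc i) j
  x-increasing = proj₁ (proj₁ x∈kP)

  x-interlacing : ∀ (i : Fin r) → Interlaces (x (suc i)) (x (inject₁ i))
  x-interlacing = proj₂ (proj₁ x∈kP)

  x-bottom : ∀ j → x zero j ≡ + 0
  x-bottom j = trans (proj₁ (proj₂ (proj₂ x∈kP)) j) (ZP.*-zeroʳ (+ k))

  x-top-tail : ∀ j → x (fromℕ r) (suc j) ≡ + k
  x-top-tail j = trans (proj₁ (proj₂ x∈kP) (suc j)) (ZP.*-identityʳ (+ k))

  x-rowSteps : ∀ (i : Fin r) → finSum (suc m) (x (suc i)) -ᶻ finSum (suc m) (x (inject₁ i)) ≡ + k *ᶻ + 1
  x-rowSteps = proj₂ (proj₂ (proj₂ x∈kP))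

  tailRow : Fin (suc r) → Fin m → ℤ
  tailRow i j = x i (suc j)

  -- Columns 1,…,m run from 0 (bottom) to k (top), so their entries lie in [0,k].
  tail-nonneg : ∀ i j → + 0 ≤ᶻ tailRow i j
  tail-nonneg i j = subst (_≤ᶻ tailRow i j) (x-bottom (suc j))
    (increasing-≥first r (λ u → tailRow u j) (λ u → x-increasing u (suc j)) i)

  tail-≤k : ∀ i j → tailRow i j ≤ᶻ + k
  tail-≤k i j = subst (tailRow i j ≤ᶻ_) (x-top-tail j)
    (increasing-≤last r (λ u → tailRow u j) (λ u → x-increasing u (suc j)) i)

  rowCount tailCount : ℕ → Fin (suc r) → ℕ
  rowCount  t i = countAbove t (x i)
  tailCount t i = countAbove t (tailRow i)

  -- Row 0 is zero and each row has at most one more entry above t than the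
  -- previous one, so row i has at most i entries above t.
  rowCount≤index : ∀ t i → rowCount t i ≤ toℕ i
  rowCount≤index t = unitSteps-bound r (rowCount t) 0
    (NP.≤-reflexive (countAbove-zeros t (x zero) x-bottom))
    (λ i → countAbove-interlace-suc t (x (suc i)) (x (inject₁ i)) (x-interlacing i))

  tailCount≤index : ∀ t i → tailCount t i ≤ toℕ i
  tailCount≤index t i = NP.≤-trans (NP.m≤n+m (tailCount t i) (above t (x i zero))) (rowCount≤index t i)

  -- The layer at threshold t: indicators [x^i_j > t] in columns j ≥ 1, and in
  -- column 0 the value completing the row sum to i.
  layer : ℕ → Array r (suc m)
  layer t i zero    = + (toℕ i ∸ tailCount t i)
  layer t i (suc j) = + above t (tailRow i j)

  layer-increasing : ∀ t (i : Fin r) j → layer t (inject₁ i) j ≤ᶻ layer t (suc i) j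
  layer-increasing t i zero rewrite FP.toℕ-inject₁ i =
    Z.+≤+ (NP.∸-monoʳ-≤ (suc (toℕ i))
      (countAbove-interlace-suc t (tailRow (suc i)) (tailRow (inject₁ i))
        (λ j j' j'≡j+1 → x-interlacing i (suc j) (suc j') (cong suc j'≡j+1))))
  layer-increasing t i (suc j) = Z.+≤+ (above-mono t (x-increasing i (suc j)))

  layer-interlacing : ∀ t (i : Fin r) → Interlaces (layer t (suc i)) (layer t (inject₁ i))
  layer-interlacing t i j       zero     ()
  layer-interlacing t i (suc j) (suc j') j'≡j+1 =
    Z.+≤+ (above-mono t (x-interlacing i (suc j) (suc j') j'≡j+1))
  layer-interlacing t i zero    (suc j') j'≡1 = Z.+≤+ (NP.m+n≤o⇒m≤o∸n _
    (NP.≤-trans (NP.+-monoˡ-≤ (tailCount t (inject₁ i)) (above-mono t (x-interlacing i zero (suc j') j'≡1)))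
                (rowCount≤index t (inject₁ i))))

  layer-rowSum : ∀ t i → finSum (suc m) (layer t i) ≡ + toℕ i
  layer-rowSum t i = trans (cong (+ (toℕ i ∸ tailCount t i) +ᶻ_) (finSum-above m t (tailRow i)))
                           (cong +_ (NP.m∸n+n≡m (tailCount≤index t i)))

  layer∈P : ∀ t → t < k → InP r (suc m) (hook h) zeroVec onesVec (layer t)
  layer∈P t t<k = (layer-increasing t , layer-interlacing t) , top , bottom , rowSteps
    where
    top : ∀ j → layer t (fromℕ r) j ≡ hook h j
    top zero rewrite FP.toℕ-fromℕ r | countAbove-const t k (tailRow (fromℕ r)) t<k x-top-tail | r≡h+m =
      cong +_ (NP.m+n∸n≡m h m)
    top (suc j) rewrite x-top-tail j = cong +_ (above-< t k t<k)
    bottom : ∀ j → layer t zero j ≡ zeroVec j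
    bottom zero    = cong +_ (NP.0∸n≡0 (tailCount t zero))
    bottom (suc j) rewrite x-bottom (suc j) = cong +_ (above-≮ t 0 (λ ()))
    rowSteps : ∀ (i : Fin r) → finSum (suc m) (layer t (suc i)) -ᶻ finSum (suc m) (layer t (inject₁ i)) ≡ onesVec i
    rowSteps i rewrite layer-rowSum t (suc i) | layer-rowSum t (inject₁ i) | FP.toℕ-inject₁ i =
      i+j-j≡i (+ toℕ i) (+ 1)

  decompose-tail : ∀ i j → tailRow i j ≡ finSum k (λ t → layer (toℕ t) i (suc j))
  decompose-tail i j = begin
    tailRow i j                                 ≡⟨ sym x≡n ⟩
    + n                                         ≡⟨ sym (layerCake k n n≤k) ⟩
    finSum k (λ t → + above (toℕ t) (+ n))      ≡⟨ finSum-cong k _ _ (λ t → cong (λ z → + above (toℕ t) z) x≡n) ⟩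
    finSum k (λ t → layer (toℕ t) i (suc j))    ∎
    where
    open ≡-Reasoning
    n = ∣ tailRow i j ∣
    x≡n : + n ≡ tailRow i j
    x≡n = ZP.0≤i⇒+∣i∣≡i (tail-nonneg i j)
    n≤k : n ≤ k
    n≤k = ZP.drop‿+≤+ (subst (_≤ᶻ + k) (sym x≡n) (tail-≤k i j))

  tailCount-sum : ∀ i → finSum k (λ t → + tailCount (toℕ t) i) ≡ finSum m (tailRow i)
  tailCount-sum i = begin
    finSum k (λ t → + tailCount (toℕ t) i)
      ≡⟨ finSum-cong k _ _ (λ t → sym (finSum-above m (toℕ t) (tailRow i))) ⟩
    finSum k (λ t → finSum m (λ j → layer (toℕ t) i (suc j)))
      ≡⟨ finSum-swap k m (λ t j → layer (toℕ t) i (suc j)) ⟩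
    finSum m (λ j → finSum k (λ t → layer (toℕ t) i (suc j)))
      ≡⟨ sym (finSum-cong m _ _ (decompose-tail i)) ⟩
    finSum m (tailRow i) ∎
    where open ≡-Reasoning

  x-rowSum : ∀ i → x i zero +ᶻ finSum m (tailRow i) ≡ + k *ᶻ + toℕ i
  x-rowSum i = begin
    finSum (suc m) (x i)
      ≡⟨ arithProgression r (λ u → finSum (suc m) (x u)) (+ k *ᶻ + 1) x-rowSteps i ⟩
    finSum (suc m) (x zero) +ᶻ + toℕ i *ᶻ (+ k *ᶻ + 1)
      ≡⟨ cong₂ _+ᶻ_ bottomSum (cong (+ toℕ i *ᶻ_) (ZP.*-identityʳ (+ k))) ⟩
    + 0 +ᶻ + toℕ i *ᶻ + k
      ≡⟨ trans (ZP.+-identityˡ _) (ZP.*-comm (+ toℕ i) (+ k)) ⟩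
    + k *ᶻ + toℕ i ∎
    where
    open ≡-Reasoning
    bottomSum : finSum (suc m) (x zero) ≡ + 0
    bottomSum = trans (finSum-cong (suc m) _ _ x-bottom)
                      (trans (finSum-const (suc m) (+ 0)) (ZP.*-zeroʳ (+ suc m)))

  layers-rowSum : ∀ i → finSum k (λ t → layer (toℕ t) i zero) +ᶻ finSum m (tailRow i) ≡ + k *ᶻ + toℕ i
  layers-rowSum i = begin
    finSum k (λ t → + (toℕ i ∸ c t)) +ᶻ finSum m (tailRow i)
      ≡⟨ cong (finSum k (λ t → + (toℕ i ∸ c t)) +ᶻ_) (sym (tailCount-sum i)) ⟩
    finSum k (λ t → + (toℕ i ∸ c t)) +ᶻ finSum k (λ t → + c t)
      ≡⟨ sym (finSum-+ k _ _) ⟩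
    finSum k (λ t → + (toℕ i ∸ c t) +ᶻ + c t)
      ≡⟨ finSum-cong k _ _ (λ t → cong +_ (NP.m∸n+n≡m (tailCount≤index (toℕ t) i))) ⟩
    finSum k (λ _ → + toℕ i)
      ≡⟨ finSum-const k (+ toℕ i) ⟩
    + k *ᶻ + toℕ i ∎
    where
    open ≡-Reasoning
    c : Fin k → ℕ
    c t = tailCount (toℕ t) i

  decompose-head : ∀ i → x i zero ≡ finSum k (λ t → layer (toℕ t) i zero)
  decompose-head i = ∙-cancelʳ (finSum m (tailRow i)) _ _ (trans (x-rowSum i) (sym (layers-rowSum i)))

  decompose : ∀ i j → x i j ≡ finSum k (λ t → layer (toℕ t) i j)
  decompose i zero    = decompose-head i
  decompose i (suc j) = decompose-tail i j

mainTheorem6 : (h l : ℕ) → 1 ≤ h → 1 ≤ l → (k : ℕ) → 1 ≤ k →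
    (x : Array (h + l ∸ 1) l) →
    InP (h + l ∸ 1) l (scale k (hook h)) (scale k zeroVec) (scale k onesVec) x →
    Σ (Fin k → Array (h + l ∸ 1) l) (λ ys →
    ((t : Fin k) → InP (h + l ∸ 1) l (hook h) zeroVec onesVec (ys t)) ×
    ((i : Fin (suc (h + l ∸ 1))) (j : Fin l) → x i j ≡ finSum k (λ t → ys t i j)))
mainTheorem6 h zero    _ () k _ x x∈kP
mainTheorem6 h (suc m) _ _  k _ x x∈kP =
  (λ t → layer (toℕ t)) , (λ t → layer∈P (toℕ t) (FP.toℕ<n t)) , decompose
  where open Layers h m (h + suc m ∸ 1) (cong (_∸ 1) (NP.+-suc h m)) k x x∈kP
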